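{- Let $\mathbb{A}$ and $\mathbb{B}$ be $\mathcal{L}$-algebras. 1. If $h:\mathbb{A}\hookrightarrow\mathbb{B}$ then $(S_{h^\delta},T_{h^\delta}):\mathbb{F}^\star_{\mathbb{B}}\twoheadrightarrow \mathbb{F}^\star_{\mathbb{A}}$. 2. If $h:\mathbb{A}\twoheadrightarrow\mathbb{B}$ then $(S_{h^\delta},T_{h^\delta}):\mathbb{F}^\star_{\mathbb{B}}\hookrightarrow \mathbb{F}^\star_{\mathbb{A}}$.
   Context: $\mathcal{L}$-algebras are normal lattice expansions; $h:\mathbb{A}\hookrightarrow\mathbb{B}$ (resp. $\twoheadrightarrow$) denotes an injective (resp. surjective) $\mathcal{L}$-homomorphism, and $h^\delta:\mathbb{A}^\delta\to\mathbb{B}^\delta$ its canonical extension, a complete $\mathcal{L}$-homomorphism between canonical extensions. For an $\mathcal{L}$-algebra $\mathbb{A}$, the filter-ideal frame $\mathbb{F}^\star_{\mathbb{A}}$ has $W$ = filters of $\mathbb{A}$, $U$ = ideals of $\mathbb{A}$, $FN^\star I$ iff $F\cap I\neq\varnothing$, $R^\star_f(I,\overline{F})$ iff $f(\overline{a})\in I$ for some $\overline{a}\in\overline{F}$, $R^\star_g(F,\overline{I})$ iff $g(\overline{a})\in F$ for some $\overline{a}\in\overline{I}$; its complex algebra $(\mathbb{F}^\star_{\mathbb{A}})^+$ is (identified with) $\mathbb{A}^\delta$. Elements $a$ of the complex algebra of a frame with polarity $(W,U,N)$ are concepts $([\![a]\!],(\![a]\!))$ with $[\![a]\!]\subseteq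 W$ the extension, $(\![a]\!)\subseteq U$ the intension, $(\![a]\!)=[\![a]\!]^\uparrow$, $[\![a]\!]=(\![a]\!)^\downarrow$, where $X^\uparrow=\{u\mid\forall w\in X\,wNu\}$, $Y^\downarrow=\{w\mid\forall u\in Y\,wNu\}$. For a complete $\mathcal{L}$-homomorphism $h:\mathbb{F}_1^+\to\mathbb{F}_2^+$, the pair $(S_h,T_h):\mathbb{F}_2\to\mathbb{F}_1$ is given by $S_h(w,u)$ iff $w\in[\![h(u^{\downarrow\uparrow})]\!]$ and $T_h(u,w)$ iff $u\in(\![h(w^{\uparrow\downarrow})]\!)$, where $u^{\downarrow\uparrow}$ denotes the concept $(\{u\}^\downarrow,\{u\}^{\downarrow\uparrow})$ and $w^{\uparrow\downarrow}$ the concept $(\{w\}^{\uparrow\downarrow},\{w\}^\uparrow)$; this is a p-morphism. A p-morphism $(S,T):\mathbb{F}_1\to\mathbb{F}_2$ ($S\subseteq W_1\times U_2$, $T\subseteq U_1\times W_2$) is surjective ($\twoheadrightarrow$) if $a\neq b$ in $\mathbb{F}_2^+$ implies $S^{(0)}[(\![a]\!)]\neq S^{(0)}[(\![b]\!)]$, and injective ($\hookrightarrow$) if for every $a\in\mathbb{F}_1^+$ there is $b\in\mathbb{F}_2^+$ with $S^{(0)}[(\![b]\!)]=[\![a]\!]$; here $S^{(0)}[Y]=\{w\in W_1\mid\forall u\in Y\,wSu\}$. -}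

module Defs where

open import Level using (0ℓ) renaming (suc to lsuc)
open import Data.Nat using (ℕ)
open import Data.Fin using (Fin; _≟_)
open import Data.Product using (Σ; ∃; _×_; _,_; proj₁; proj₂)
open import Relation.Nullary using (¬_; yes; no)
open import Relation.Unary using (Pred; _≐_)
open import Relation.Binary.PropositionalEquality using (_≡_)
open import Relation.Binary.Lattice.Bundles using (BoundedLattice)
open import Function using (_∘_; id)
open import Function.Bundles using (_⇔_; mk⇔)

data Polarity : Set where
  pos neg : Polarity

record Signature : Set₁ where
  field
    FOp GOp : Set
    fArity  : FOp → ℕ
    gArity  : GOp → ℕ
    fType   : (f : FOp) → Fin (fArity f) → Polarity
    gType   : (g : GOp) → Fin (gArity g) → Polarity

upd : ∀ {C : Set} {n} → (Fin n → C) → Fin n → C → Fin n → C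
upd xs i c j with i ≟ j
... | yes _ = c
... | no  _ = xs j

record LAlgebra (𝓛 : Signature) : Set₁ where
  open Signature 𝓛
  field
    bl : BoundedLattice 0ℓ 0ℓ 0ℓ
  open BoundedLattice bl public
  field
    fOp : (f : FOp) → (Fin (fArity f) → Carrier) → Carrier
    gOp : (g : GOp) → (Fin (gArity g) → Carrier) → Carrier
    fOp-cong : ∀ f {xs ys} → (∀ i → xs i ≈ ys i) → fOp f xs ≈ fOp f ys
    gOp-cong : ∀ g {xs ys} → (∀ i → xs i ≈ ys i) → gOp g xs ≈ gOp g ys
    f-⊥ : ∀ f xs i → fType f i ≡ pos → fOp f (upd xs i ⊥) ≈ ⊥
    f-∨ : ∀ f xs i a b → fType f i ≡ pos →
          fOp f (upd xs i (a ∨ b)) ≈ (fOp f (upd xs i a) ∨ fOp f (upd xs i b))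
    f-⊤ : ∀ f xs i → fType f i ≡ neg → fOp f (upd xs i ⊤) ≈ ⊥
    f-∧ : ∀ f xs i a b → fType f i ≡ neg →
          fOp f (upd xs i (a ∧ b)) ≈ (fOp f (upd xs i a) ∨ fOp f (upd xs i b))
    g-⊤ : ∀ g xs i → gType g i ≡ pos → gOp g (upd xs i ⊤) ≈ ⊤
    g-∧ : ∀ g xs i a b → gType g i ≡ pos →
          gOp g (upd xs i (a ∧ b)) ≈ (gOp g (upd xs i a) ∧ gOp g (upd xs i b))
    g-⊥ : ∀ g xs i → gType g i ≡ neg → gOp g (upd xs i ⊥) ≈ ⊤
    g-∨ : ∀ g xs i a b → gType g i ≡ neg →
          gOp g (upd xs i (a ∨ b)) ≈ (gOp g (upd xs i a) ∧ gOp g (upd xs i b))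

module _ {𝓛 : Signature} (A B : LAlgebra 𝓛) where
  private
    module A = LAlgebra A
    module B = LAlgebra B

  record IsLHom (h : A.Carrier → B.Carrier) : Set where
    field
      cong  : ∀ {x y} → x A.≈ y → h x B.≈ h y
      ∨-hom : ∀ x y → h (x A.∨ y) B.≈ (h x B.∨ h y)
      ∧-hom : ∀ x y → h (x A.∧ y) B.≈ (h x B.∧ h y)
      ⊤-hom : h A.⊤ B.≈ B.⊤
      ⊥-hom : h A.⊥ B.≈ B.⊥
      f-hom : ∀ f xs → h (A.fOp f xs) B.≈ B.fOp f (h ∘ xs)
      g-hom : ∀ g xs → h (A.gOp g xs) B.≈ B.gOp g (h ∘ xs)

  InjectiveMap : (A.Carrier → B.Carrier) → Set
  InjectiveMap h = ∀ x y → h x B.≈ h y → x A.≈ y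

  SurjectiveMap : (A.Carrier → B.Carrier) → Set
  SurjectiveMap h = ∀ b → ∃ λ a → h a B.≈ b

module Pol {W U : Set₁} (N : W → U → Set) where

  _↑ : Pred W (lsuc 0ℓ) → Pred U (lsuc 0ℓ)
  (X ↑) u = ∀ w → X w → N w u

  _↓ : Pred U (lsuc 0ℓ) → Pred W (lsuc 0ℓ)
  (Y ↓) w = ∀ u → Y u → N w u

  -- elements of the complex algebra: concepts ([[a]], (|a|))
  record Concept : Set₂ where
    field
      ext    : Pred W (lsuc 0ℓ)
      int    : Pred U (lsuc 0ℓ)
      int-eq : ∀ u → int u ⇔ (ext ↑) u
      ext-eq : ∀ w → ext w ⇔ (int ↓) w
  open Concept public

  _≈C_ : Concept → Concept → Set₁
  a ≈C b = ext a ≐ ext b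

  closureW : Pred W (lsuc 0ℓ) → Concept
  closureW X = record
    { ext = (X ↑) ↓
    ; int = X ↑
    ; int-eq = λ u → mk⇔ (λ p w q → q u p)
                         (λ p w x → p w (λ u' q → q w x))
    ; ext-eq = λ w → mk⇔ id id
    }

  closureU : Pred U (lsuc 0ℓ) → Concept
  closureU Y = record
    { ext = Y ↓
    ; int = (Y ↓) ↑
    ; int-eq = λ u → mk⇔ id id
    ; ext-eq = λ w → mk⇔ (λ p u q → q w p)
                         (λ p u y → p u (λ w' q → q u y))
    }

  ⟦_⟧U : U → Concept
  ⟦ u ⟧U = closureU (λ u' → u' ≡ u)

module _ {𝓛 : Signature} (A : LAlgebra 𝓛) where
  open LAlgebra A

  record Filter : Set₁ where
    field
      mem  : Carrier → Set
      top  : mem ⊤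
      up   : ∀ {x y} → x ≤ y → mem x → mem y
      meet : ∀ {x y} → mem x → mem y → mem (x ∧ y)

  record Ideal : Set₁ where
    field
      mem  : Carrier → Set
      bot  : mem ⊥
      down : ∀ {x y} → y ≤ x → mem x → mem y
      join : ∀ {x y} → mem x → mem y → mem (x ∨ y)

  N⋆ : Filter → Ideal → Set
  N⋆ F I = ∃ λ a → Filter.mem F a × Ideal.mem I a

  -- elements of A^δ = (𝔽⋆_A)^+
  Aδ : Set₂
  Aδ = Pol.Concept N⋆

-- Canonical extension h^δ : A^δ → B^δ of a homomorphism, computed on
-- (𝔽⋆_A)^+ ≅ A^δ:  h^δ(x) = ⋁ { ⋀ h[F] | F ∈ [[x]] }  (σ-extension),
-- i.e.  [[h^δ x]] = ({ G | ∃ F ∈ [[x]], h[F] ⊆ G })^{↑↓}.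

module _ {𝓛 : Signature} (A B : LAlgebra 𝓛) where
  private
    module A = LAlgebra A
    module B = LAlgebra B
    module PA = Pol (N⋆ A)
    module PB = Pol (N⋆ B)

  hδ : (A.Carrier → B.Carrier) → Aδ A → Aδ B
  hδ h x = PB.closureW (λ G → Σ (Filter A) λ F →
             PA.ext x F × (∀ a → Filter.mem F a → Filter.mem G (h a)))

  Sδ : (A.Carrier → B.Carrier) → Filter B → Ideal A → Set₁
  Sδ h G I = PB.ext (hδ h (PA.⟦ I ⟧U)) G

module _ {W₁ U₂ : Set₁} (S : W₁ → U₂ → Set₁) where
  S⁰ : Pred U₂ (lsuc 0ℓ) → Pred W₁ (lsuc 0ℓ)
  S⁰ Y w = ∀ u → Y u → S w u

module _ {W₁ U₁ W₂ U₂ : Set₁} (N₁ : W₁ → U₁ → Set) (N₂ : W₂ → U₂ → Set)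
         (S : W₁ → U₂ → Set₁) where
  private
    module P₁ = Pol N₁
    module P₂ = Pol N₂

  SurjectiveS : Set₂
  SurjectiveS = ∀ (a b : P₂.Concept) → ¬ (a P₂.≈C b) →
                ¬ (S⁰ S (P₂.int a) ≐ S⁰ S (P₂.int b))

  InjectiveS : Set₂
  InjectiveS = ∀ (a : P₁.Concept) → Σ P₂.Concept λ b →
               S⁰ S (P₂.int b) ≐ P₁.ext a

{-# OPTIONS --safe #-}
-- Everything rests on one computation: S_{h^δ}(G, I) holds iff the preimage
-- filter h⁻¹[G] meets I, so S^{(0)}[(|a|)] = { G | h⁻¹[G] ∈ [[a]] }.
-- If h is injective then F = h⁻¹[⟨h[F]⟩] for every filter F of A, so this
-- set determines [[a]].  If h is surjective then G meets J iff h⁻¹[G] meets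
-- h⁻¹[J], so the concept of A^δ generated by the preimages of the ideals in
-- (|b|) is sent by S^{(0)} to [[b]].
module Submission where

open import Defs
open import Data.Product using (_×_; _,_; Σ)
open import Function using (_∘_)
open import Function.Bundles using (_⇔_; mk⇔; Equivalence)
open import Function.Construct.Composition using (_⇔-∘_)
open import Relation.Binary.PropositionalEquality using (refl)
open import Relation.Unary using (_⊆_; _≐_)
import Relation.Binary.Lattice.Properties.JoinSemilattice as JoinSemilatticeProperties

open Equivalence using (to; from)

module _ {𝓛 : Signature} (A : LAlgebra 𝓛) where
  open Pol (N⋆ A)

  ext-mono : (a : Aδ A) {F F′ : Filter A} →
             Filter.mem F ⊆ Filter.mem F′ → ext a F → ext a F′
  ext-mono a {F} {F′} F⊆F′ F∈a =
    from (ext-eq a F′) λ I I∈a →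
      let (x , x∈F , x∈I) = to (ext-eq a F) F∈a I I∈a in x , F⊆F′ x∈F , x∈I

module Homomorphism {𝓛 : Signature} (A B : LAlgebra 𝓛)
                    {h : LAlgebra.Carrier A → LAlgebra.Carrier B}
                    (hom : IsLHom A B h) where
  private
    module A = LAlgebra A
    module B = LAlgebra B
    module H = IsLHom hom
    module PA = Pol (N⋆ A)
    module PB = Pol (N⋆ B)
    module A∨ = JoinSemilatticeProperties A.joinSemilattice
    module B∨ = JoinSemilatticeProperties B.joinSemilattice

  S : Filter B → Ideal A → Set₁
  S = Sδ A B h

  h-mono : ∀ {x y} → x A.≤ y → h x B.≤ h y
  h-mono {x} {y} x≤y = B.trans (B.x≤x∨y (h x) (h y))
    (B.reflexive (B.Eq.trans (B.Eq.sym (H.∨-hom x y)) (H.cong (A∨.x≤y⇒x∨y≈y x≤y))))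

  injective⇒h-reflects-≤ : InjectiveMap A B h → ∀ {x y} → h x B.≤ h y → x A.≤ y
  injective⇒h-reflects-≤ inj {x} {y} hx≤hy = A.trans (A.x≤x∨y x y) (A.reflexive x∨y≈y)
    where
    x∨y≈y : (x A.∨ y) A.≈ y
    x∨y≈y = inj _ _ (B.Eq.trans (H.∨-hom x y) (B∨.x≤y⇒x∨y≈y hx≤hy))

  preimageFilter : Filter B → Filter A
  preimageFilter G = record
    { mem  = λ x → Filter.mem G (h x)
    ; top  = Filter.up G (B.reflexive (B.Eq.sym H.⊤-hom)) (Filter.top G)
    ; up   = Filter.up G ∘ h-mono
    ; meet = λ {x} {y} hx∈G hy∈G →
        Filter.up G (B.reflexive (B.Eq.sym (H.∧-hom x y))) (Filter.meet G hx∈G hy∈G)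
    }

  preimageIdeal : Ideal B → Ideal A
  preimageIdeal J = record
    { mem  = λ x → Ideal.mem J (h x)
    ; bot  = Ideal.down J (B.reflexive H.⊥-hom) (Ideal.bot J)
    ; down = Ideal.down J ∘ h-mono
    ; join = λ {x} {y} hx∈J hy∈J →
        Ideal.down J (B.reflexive (H.∨-hom x y)) (Ideal.join J hx∈J hy∈J)
    }

  imageFilter : Filter A → Filter B
  imageFilter F = record
    { mem  = λ y → Σ A.Carrier λ x → Filter.mem F x × h x B.≤ y
    ; top  = A.⊤ , Filter.top F , B.maximum (h A.⊤)
    ; up   = λ { y≤y′ (x , x∈F , hx≤y) → x , x∈F , B.trans hx≤y y≤y′ }
    ; meet = λ { (x₁ , x₁∈F , hx₁≤y₁) (x₂ , x₂∈F , hx₂≤y₂) →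
        x₁ A.∧ x₂ , Filter.meet F x₁∈F x₂∈F ,
        B.∧-greatest (B.trans (h-mono (A.x∧y≤x x₁ x₂)) hx₁≤y₁)
                     (B.trans (h-mono (A.x∧y≤y x₁ x₂)) hx₂≤y₂) }
    }

  imageIdeal : Ideal A → Ideal B
  imageIdeal I = record
    { mem  = λ y → Σ A.Carrier λ x → Ideal.mem I x × y B.≤ h x
    ; bot  = A.⊥ , Ideal.bot I , B.minimum (h A.⊥)
    ; down = λ { y′≤y (x , x∈I , y≤hx) → x , x∈I , B.trans y′≤y y≤hx }
    ; join = λ { (x₁ , x₁∈I , y₁≤hx₁) (x₂ , x₂∈I , y₂≤hx₂) →
        x₁ A.∨ x₂ , Ideal.join I x₁∈I x₂∈I ,
        B.∨-least (B.trans y₁≤hx₁ (h-mono (A.x≤x∨y x₁ x₂)))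
                  (B.trans y₂≤hx₂ (h-mono (A.y≤x∨y x₁ x₂))) }
    }

  ⊆preimage-imageFilter : (F : Filter A) →
                          Filter.mem F ⊆ Filter.mem (preimageFilter (imageFilter F))
  ⊆preimage-imageFilter F x∈F = _ , x∈F , B.refl

  injective⇒preimage-imageFilter⊆ : InjectiveMap A B h → (F : Filter A) →
                                    Filter.mem (preimageFilter (imageFilter F)) ⊆ Filter.mem F
  injective⇒preimage-imageFilter⊆ inj F (x′ , x′∈F , hx′≤hx) =
    Filter.up F (injective⇒h-reflects-≤ inj hx′≤hx) x′∈F

  S⇔preimageFilter-meets : ∀ G I → S G I ⇔ N⋆ A (preimageFilter G) I
  S⇔preimageFilter-meets G I = mk⇔ S⇒meets meets⇒S
    where
    imageIdeal∈int-hδ : PB.int (hδ A B h PA.⟦ I ⟧U) (imageIdeal I)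
    imageIdeal∈int-hδ G′ (F , F∈⟦I⟧ , h[F]⊆G′) =
      let (x , x∈F , x∈I) = F∈⟦I⟧ I refl
      in h x , h[F]⊆G′ x x∈F , x , x∈I , B.refl

    S⇒meets : S G I → N⋆ A (preimageFilter G) I
    S⇒meets s with s (imageIdeal I) imageIdeal∈int-hδ
    ... | y , y∈G , x , x∈I , y≤hx = x , Filter.up G y≤hx y∈G , x∈I

    meets⇒S : N⋆ A (preimageFilter G) I → S G I
    meets⇒S G⁻¹∩I J J∈X↑ =
      J∈X↑ G (preimageFilter G , (λ { _ refl → G⁻¹∩I }) , λ _ hx∈G → hx∈G)

  S⁰-int⇔ext-preimageFilter : (a : Aδ A) (G : Filter B) →
                              S⁰ S (PA.int a) G ⇔ PA.ext a (preimageFilter G)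
  S⁰-int⇔ext-preimageFilter a G = mk⇔
    (λ G∈S⁰ → from (PA.ext-eq a _) λ I I∈a → to (S⇔preimageFilter-meets G I) (G∈S⁰ I I∈a))
    (λ G⁻¹∈a I I∈a → from (S⇔preimageFilter-meets G I) (to (PA.ext-eq a _) G⁻¹∈a I I∈a))

  injective⇒S⁰-int-reflects-⊆ : InjectiveMap A B h → (a b : Aδ A) →
                                S⁰ S (PA.int a) ⊆ S⁰ S (PA.int b) → PA.ext a ⊆ PA.ext b
  injective⇒S⁰-int-reflects-⊆ inj a b S⁰a⊆S⁰b {F} F∈a =
    ext-mono A b (injective⇒preimage-imageFilter⊆ inj F)
      (to (S⁰-int⇔ext-preimageFilter b (imageFilter F))
        (S⁰a⊆S⁰b {imageFilter F}
          (from (S⁰-int⇔ext-preimageFilter a (imageFilter F))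
            (ext-mono A a (⊆preimage-imageFilter F) F∈a))))

  injective⇒surjectiveS : InjectiveMap A B h → SurjectiveS (N⋆ B) (N⋆ A) S
  injective⇒surjectiveS inj a b a≉b (S⁰a⊆S⁰b , S⁰b⊆S⁰a) =
    a≉b ( injective⇒S⁰-int-reflects-⊆ inj a b (λ {G} → S⁰a⊆S⁰b {G})
        , injective⇒S⁰-int-reflects-⊆ inj b a (λ {G} → S⁰b⊆S⁰a {G}) )

  preimages-meet⇒meets : ∀ {G J} → N⋆ A (preimageFilter G) (preimageIdeal J) → N⋆ B G J
  preimages-meet⇒meets (x , hx∈G , hx∈J) = h x , hx∈G , hx∈J

  surjective⇒preimages-meet : SurjectiveMap A B h → ∀ {G J} →
                              N⋆ B G J → N⋆ A (preimageFilter G) (preimageIdeal J)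
  surjective⇒preimages-meet surj {G} {J} (y , y∈G , y∈J) =
    let (x , hx≈y) = surj y
    in x , Filter.up G (B.reflexive (B.Eq.sym hx≈y)) y∈G
         , Ideal.down J (B.reflexive hx≈y) y∈J

  preimageConcept : Aδ B → Aδ A
  preimageConcept b = PA.closureU λ I →
    Σ (Ideal B) λ J → PB.int b J × Ideal.mem (preimageIdeal J) ⊆ Ideal.mem I

  surjective⇒ext-preimageConcept⇔ : SurjectiveMap A B h → (b : Aδ B) (G : Filter B) →
                                    PA.ext (preimageConcept b) (preimageFilter G) ⇔ PB.ext b G
  surjective⇒ext-preimageConcept⇔ surj b G = mk⇔
    (λ G⁻¹∈c → from (PB.ext-eq b G) λ J J∈b →
       preimages-meet⇒meets {G} {J} (G⁻¹∈c (preimageIdeal J) (J , J∈b , λ {_} hx∈J → hx∈J)))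
    (λ G∈b I (J , J∈b , J⁻¹⊆I) →
       let (x , hx∈G , hx∈J) =
             surjective⇒preimages-meet surj {G} {J} (to (PB.ext-eq b G) G∈b J J∈b)
       in x , hx∈G , J⁻¹⊆I hx∈J)

  surjective⇒injectiveS : SurjectiveMap A B h → InjectiveS (N⋆ B) (N⋆ A) S
  surjective⇒injectiveS surj b = preimageConcept b , S⁰≐b
    where
    S⁰⇔b : ∀ G → S⁰ S (PA.int (preimageConcept b)) G ⇔ PB.ext b G
    S⁰⇔b G = surjective⇒ext-preimageConcept⇔ surj b G
         ⇔-∘ S⁰-int⇔ext-preimageFilter (preimageConcept b) G

    S⁰≐b : S⁰ S (PA.int (preimageConcept b)) ≐ PB.ext b
    S⁰≐b = (λ {G} → to (S⁰⇔b G)) , (λ {G} → from (S⁰⇔b G))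

mainTheorem4 : ∀ {𝓛 : Signature} (A B : LAlgebra 𝓛)
    (h : LAlgebra.Carrier A → LAlgebra.Carrier B) → IsLHom A B h →
    (InjectiveMap A B h → SurjectiveS (N⋆ B) (N⋆ A) (Sδ A B h))
    × (SurjectiveMap A B h → InjectiveS (N⋆ B) (N⋆ A) (Sδ A B h))
mainTheorem4 A B h hom = injective⇒surjectiveS , surjective⇒injectiveS
  where open Homomorphism A B hom
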